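{- Let $B$ be a minimum-weight basis of a weighted uncertainty matroid $\mathcal{M}=(E,\mathcal{I},A,w)$ and let $Q$ be a set that verifies $B$. Let $e\in B$ and $e'\notin B$ with $U_e=U_{e'}=w_e=w_{e'}$ be such that $e\in C_{e'}$, where $C_{e'}$ is the fundamental circuit of $e'$ with respect to $B$. Then $Q'=(Q\setminus\{e'\})\cup\{e\}$ is a certificate that verifies $B'=(B\setminus\{e\})\cup\{e'\}$.
   Context: A weighted uncertainty matroid $\mathcal{M}=(E,\mathcal{I},A,w)$ consists of a matroid $(E,\mathcal{I})$ on a finite set $E$, for each $e$ an uncertainty area $A_e\subseteq\mathbb{R}$ (a non-empty finite union of bounded real intervals, open or closed, single points allowed), and a weight $w_e\in A_e$; $L_e=\inf A_e$, $U_e=\sup A_e$. For a basis $B$ and $f\notin B$, the fundamental circuit $C_f$ is the unique circuit contained in $B\cup\{f\}$. A minimum-weight basis (MWB) minimizes $\sum_{e\in B}w_e$. A weight assignment consistent with $Q$ is $w^*$ with $w^*_e\in A_e$ for all $e$ and $w^*_e=w_e$ for $e\in Q$. $Q$ verifies the MWB $B$ (is a certificate for $B$) if for every weight assignment $w^*$ consistent with $Q$, $B$ is an MWB of $(E,\mathcal{I},w^*)$. -}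

module Defs where

open import Data.Nat using (ℕ; zero; suc; _<_)
open import Data.Fin using (Fin; zero; suc)
open import Data.Fin.Subset using (Subset; _∈_; _∉_; _⊆_; _∪_; _-_; ⁅_⁆; ∣_∣) renaming (⊥ to ∅)
open import Data.Bool using (Bool; true; false; if_then_else_)
open import Data.List using (List)
open import Data.List.Relation.Unary.Any using (Any)
open import Data.Vec using (Vec; []; _∷_)
open import Data.Product using (Σ; _×_; ∃; ∃-syntax; _,_)
open import Data.Sum using (_⊎_)
open import Relation.Nullary using (¬_)
open import Relation.Binary.PropositionalEquality using (_≡_)

-- Weight domain: a totally ordered abelian group (ℝ is an instance).

record OrderedAbelianGroup : Set₁ where
  infixl 6 _+_
  infix 4 _≤_ _<ᵍ_
  field
    Carrier : Set
    _+_     : Carrier → Carrier → Carrier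
    0#      : Carrier
    -_      : Carrier → Carrier
    _≤_     : Carrier → Carrier → Set
    +-assoc    : ∀ x y z → (x + y) + z ≡ x + (y + z)
    +-comm     : ∀ x y → x + y ≡ y + x
    +-identityˡ : ∀ x → 0# + x ≡ x
    -‿inverseˡ : ∀ x → (- x) + x ≡ 0#
    ≤-refl    : ∀ x → x ≤ x
    ≤-trans   : ∀ {x y z} → x ≤ y → y ≤ z → x ≤ z
    ≤-antisym : ∀ {x y} → x ≤ y → y ≤ x → x ≡ y
    ≤-total   : ∀ x y → x ≤ y ⊎ y ≤ x
    +-mono-≤  : ∀ {x y} z → x ≤ y → x + z ≤ y + z

  _<ᵍ_ : Carrier → Carrier → Set
  x <ᵍ y = x ≤ y × ¬ (x ≡ y)

record Matroid (n : ℕ) : Set₁ where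
  field
    Indep : Subset n → Set
    indep-∅   : Indep ∅
    indep-sub : ∀ {X Y} → X ⊆ Y → Indep Y → Indep X
    indep-aug : ∀ {X Y} → Indep X → Indep Y → ∣ X ∣ < ∣ Y ∣ →
                ∃[ e ] (e ∈ Y × e ∉ X × Indep (X ∪ ⁅ e ⁆))

module _ {n : ℕ} (M : Matroid n) where
  open Matroid M

  IsBasis : Subset n → Set
  IsBasis B = Indep B × (∀ X → Indep X → B ⊆ X → X ⊆ B)

  IsCircuit : Subset n → Set
  IsCircuit C = ¬ Indep C × (∀ X → X ⊆ C → ¬ (C ⊆ X) → Indep X)

  InFundCircuit : Subset n → Fin n → Fin n → Set
  InFundCircuit B f e = ∃[ C ] (IsCircuit C × C ⊆ B ∪ ⁅ f ⁆ × e ∈ C)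

-- Uncertainty areas: finite unions of bounded intervals, each end open
-- or closed (a closed interval [a,a] is a single point).

module _ (G : OrderedAbelianGroup) where
  open OrderedAbelianGroup G

  record Interval : Set where
    field
      lo hi : Carrier
      loClosed hiClosed : Bool

  _∈I_ : Carrier → Interval → Set
  x ∈I i = (if Interval.loClosed i then Interval.lo i ≤ x else Interval.lo i <ᵍ x)
         × (if Interval.hiClosed i then x ≤ Interval.hi i else x <ᵍ Interval.hi i)

  Area : Set
  Area = List Interval

  _∈A_ : Carrier → Area → Set
  x ∈A A = Any (x ∈I_) A

  wsum : ∀ {n} → (Fin n → Carrier) → Subset n → Carrier
  wsum {zero}  w []       = 0#
  wsum {suc n} w (b ∷ s) = (if b then w zero else 0#) + wsum (λ i → w (suc i)) s

  record UncertaintyMatroid (n : ℕ) : Set₁ where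
    field
      matroid : Matroid n
      area    : Fin n → Area
      weight  : Fin n → Carrier
      weight∈area : ∀ e → weight e ∈A area e

  module _ {n : ℕ} (𝓜 : UncertaintyMatroid n) where
    open UncertaintyMatroid 𝓜

    IsMWB : (Fin n → Carrier) → Subset n → Set
    IsMWB w* B = IsBasis matroid B × (∀ B′ → IsBasis matroid B′ → wsum w* B ≤ wsum w* B′)

    Consistent : Subset n → (Fin n → Carrier) → Set
    Consistent Q w* = (∀ e → w* e ∈A area e) × (∀ e → e ∈ Q → w* e ≡ weight e)

    Verifies : Subset n → Subset n → Set
    Verifies Q B = ∀ w* → Consistent Q w* → IsMWB w* B

    -- U_e = w_e  (since w_e ∈ A_e, sup A_e = w_e iff w_e is an upper bound of A_e)
    UpperIsWeight : Fin n → Set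
    UpperIsWeight e = ∀ x → x ∈A area e → x ≤ weight e

-- Given a weight assignment w* consistent with Q′, reset the weight of e′ to w_{e′}. The result
-- is consistent with Q (e′ is the only element of Q missing from Q′), so B is a minimum-weight
-- basis for it. Under the reset weights e and e′ weigh the same (w*_e = w_e because e ∈ Q′), so
-- the basis B′ obtained by exchanging e for e′ along the fundamental circuit is minimum-weight
-- as well. Finally, going back to w* only lowers the weight of e′, since w_{e′} = U_{e′}; this
-- keeps B′ ∋ e′ at most as heavy as any other basis.
module Submission where

open import Defs
open import Data.Nat using (ℕ)
open import Data.Fin using (Fin; zero; suc; _≟_)
open import Data.Fin.Subset using (Subset; _∈_; _∉_; _⊆_; _∪_; _─_; _-_; ⁅_⁆; ∣_∣; inside; outside)
open import Data.Fin.Subset.Properties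
  using (_∈?_; p⊆p∪q; q⊆p∪q; x∈p∪q⁻; x∈⁅x⁆; x∈⁅y⁆⇒x≡y; ∣⁅x⁆∣≡1; p─q⊆p; p─⊥≡p; ⊆-antisym;
         x∈p∧x≢y⇒x∈p-y; x∈p⇒∣p-x∣<∣p∣; p⊆q⇒∣p∣≤∣q∣; p⊂q⇒∣p∣<∣q∣)
open import Data.Vec.Base using ([]; _∷_; module _[_]=_)
open _[_]=_ using (here; there)
open import Data.Vec.Functional using (updateAt)
open import Data.Vec.Functional.Properties using (updateAt-updates; updateAt-minimal)
open import Data.Bool using (true; false)
open import Data.Product using (∃-syntax; _×_; _,_; proj₁; proj₂)
open import Data.Sum using (inj₁; inj₂)
open import Function using (_∘_; const)
open import Relation.Nullary using (yes; no; contradiction)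
open import Relation.Binary.PropositionalEquality
  using (_≡_; _≢_; refl; sym; trans; cong; cong₂; subst; subst₂; isEquivalence; module ≡-Reasoning)

module SubsetProperties where
  open import Data.Nat using (suc; _≤_; _<_; _+_; z≤n; s≤s)
  open import Data.Nat.Properties
    using (≤-trans; ≤-reflexive; n≤1+n; +-suc; +-comm; +-monoʳ-≤; ≤⇒≯; module ≤-Reasoning)

  private variable
    n : ℕ
    x y : Fin n

  x∈p─q⇒x∉q : (p q : Subset n) → x ∈ p ─ q → x ∉ q
  x∈p─q⇒x∉q (_ ∷ p) (inside  ∷ q) ()        here
  x∈p─q⇒x∉q (_ ∷ p) (outside ∷ q) here      ()
  x∈p─q⇒x∉q (_ ∷ p) (_       ∷ q) (there m) (there m′) = x∈p─q⇒x∉q p q m m′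

  x∈p-y⇒x≢y : (p : Subset n) → x ∈ p - y → x ≢ y
  x∈p-y⇒x≢y {y = y} p m refl = x∈p─q⇒x∉q p ⁅ y ⁆ m (x∈⁅x⁆ y)

  p∪⁅x⁆-x≡p : {p : Subset n} → x ∉ p → (p ∪ ⁅ x ⁆) - x ≡ p
  p∪⁅x⁆-x≡p {x = x} {p} x∉p = ⊆-antisym ⊆p p⊆
    where
    ⊆p : (p ∪ ⁅ x ⁆) - x ⊆ p
    ⊆p {y} m with x∈p∪q⁻ p ⁅ x ⁆ (p─q⊆p _ _ m)
    ... | inj₁ y∈p = y∈p
    ... | inj₂ y∈x = contradiction (x∈⁅y⁆⇒x≡y x y∈x) (x∈p-y⇒x≢y _ m)
    p⊆ : p ⊆ (p ∪ ⁅ x ⁆) - x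
    p⊆ y∈p = x∈p∧x≢y⇒x∈p-y (p⊆p∪q _ y∈p) λ { refl → x∉p y∈p }

  ∣p∪q∣≤∣p∣+∣q∣ : (p q : Subset n) → ∣ p ∪ q ∣ ≤ ∣ p ∣ + ∣ q ∣
  ∣p∪q∣≤∣p∣+∣q∣ []            []            = z≤n
  ∣p∪q∣≤∣p∣+∣q∣ (inside  ∷ p) (inside  ∷ q) = s≤s (≤-trans (∣p∪q∣≤∣p∣+∣q∣ p q) (+-monoʳ-≤ ∣ p ∣ (n≤1+n _)))
  ∣p∪q∣≤∣p∣+∣q∣ (inside  ∷ p) (outside ∷ q) = s≤s (∣p∪q∣≤∣p∣+∣q∣ p q)
  ∣p∪q∣≤∣p∣+∣q∣ (outside ∷ p) (inside  ∷ q) = ≤-trans (s≤s (∣p∪q∣≤∣p∣+∣q∣ p q)) (≤-reflexive (sym (+-suc ∣ p ∣ ∣ q ∣)))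
  ∣p∪q∣≤∣p∣+∣q∣ (outside ∷ p) (outside ∷ q) = ∣p∪q∣≤∣p∣+∣q∣ p q

  x∉p⇒∣p∣<∣p∪⁅x⁆∣ : {p : Subset n} → x ∉ p → ∣ p ∣ < ∣ p ∪ ⁅ x ⁆ ∣
  x∉p⇒∣p∣<∣p∪⁅x⁆∣ {x = x} {p} x∉p = p⊂q⇒∣p∣<∣q∣ (p⊆p∪q ⁅ x ⁆ , x , q⊆p∪q p ⁅ x ⁆ (x∈⁅x⁆ x) , x∉p)

  x∈p⇒∣p-x∪⁅y⁆∣≤∣p∣ : {p : Subset n} → x ∈ p → ∣ (p - x) ∪ ⁅ y ⁆ ∣ ≤ ∣ p ∣
  x∈p⇒∣p-x∪⁅y⁆∣≤∣p∣ {x = x} {y} {p} x∈p = begin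
    ∣ (p - x) ∪ ⁅ y ⁆ ∣     ≤⟨ ∣p∪q∣≤∣p∣+∣q∣ (p - x) ⁅ y ⁆ ⟩
    ∣ p - x ∣ + ∣ ⁅ y ⁆ ∣   ≡⟨ cong (∣ p - x ∣ +_) (∣⁅x⁆∣≡1 y) ⟩
    ∣ p - x ∣ + 1           ≡⟨ +-comm ∣ p - x ∣ 1 ⟩
    suc ∣ p - x ∣           ≤⟨ x∈p⇒∣p-x∣<∣p∣ x∈p ⟩
    ∣ p ∣                   ∎
    where open ≤-Reasoning

  p⊆q∧∣q∣≤∣p∣⇒q⊆p : {p q : Subset n} → p ⊆ q → ∣ q ∣ ≤ ∣ p ∣ → q ⊆ p
  p⊆q∧∣q∣≤∣p∣⇒q⊆p {p = p} p⊆q ∣q∣≤∣p∣ {x} x∈q with x ∈? p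
  ... | yes x∈p = x∈p
  ... | no  x∉p = contradiction (p⊂q⇒∣p∣<∣q∣ (p⊆q , x , x∈q , x∉p)) (≤⇒≯ ∣q∣≤∣p∣)

open SubsetProperties

module MatroidProperties {n} (M : Matroid n) where
  open import Data.Nat using (zero; suc; _≤_; _+_)
  open import Data.Nat.Properties using (≤-trans; ≤-reflexive; +-suc; +-monoʳ-≤; m≤m+n; ≰⇒>; _≤?_)
  open Matroid M

  indep-grow : ∀ {X Y} → Indep X → Indep Y →
               ∃[ Z ] (Indep Z × X ⊆ Z × Z ⊆ X ∪ Y × ∣ Y ∣ ≤ ∣ Z ∣)
  indep-grow {X} {Y} iX iY = grow ∣ Y ∣ X iX (λ x∈X → x∈X) (p⊆p∪q Y) (m≤m+n ∣ Y ∣ ∣ X ∣)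
    where
    grow : ∀ k Z → Indep Z → X ⊆ Z → Z ⊆ X ∪ Y → ∣ Y ∣ ≤ k + ∣ Z ∣ →
           ∃[ Z′ ] (Indep Z′ × X ⊆ Z′ × Z′ ⊆ X ∪ Y × ∣ Y ∣ ≤ ∣ Z′ ∣)
    grow zero    Z iZ X⊆Z Z⊆X∪Y bound = Z , iZ , X⊆Z , Z⊆X∪Y , bound
    grow (suc k) Z iZ X⊆Z Z⊆X∪Y bound with ∣ Y ∣ ≤? ∣ Z ∣
    ... | yes ∣Y∣≤∣Z∣ = Z , iZ , X⊆Z , Z⊆X∪Y , ∣Y∣≤∣Z∣
    ... | no  ∣Y∣≰∣Z∣ with indep-aug iZ iY (≰⇒> ∣Y∣≰∣Z∣)
    ... | g , g∈Y , g∉Z , iZ+g =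
      grow k (Z ∪ ⁅ g ⁆) iZ+g (p⊆p∪q ⁅ g ⁆ ∘ X⊆Z) Z+g⊆X∪Y
           (≤-trans bound (≤-trans (≤-reflexive (sym (+-suc k ∣ Z ∣))) (+-monoʳ-≤ k (x∉p⇒∣p∣<∣p∪⁅x⁆∣ g∉Z))))
      where
      Z+g⊆X∪Y : Z ∪ ⁅ g ⁆ ⊆ X ∪ Y
      Z+g⊆X∪Y m with x∈p∪q⁻ Z ⁅ g ⁆ m
      ... | inj₁ m∈Z = Z⊆X∪Y m∈Z
      ... | inj₂ m∈g with x∈⁅y⁆⇒x≡y g m∈g
      ... | refl = q⊆p∪q X Y g∈Y

  ∣indep∣≤∣basis∣ : ∀ {B X} → IsBasis M B → Indep X → ∣ X ∣ ≤ ∣ B ∣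
  ∣indep∣≤∣basis∣ {B} {X} (iB , maxB) iX with ∣ X ∣ ≤? ∣ B ∣
  ... | yes ∣X∣≤∣B∣ = ∣X∣≤∣B∣
  ... | no  ∣X∣≰∣B∣ with indep-aug iB iX (≰⇒> ∣X∣≰∣B∣)
  ... | g , _ , g∉B , iB+g = contradiction (maxB (B ∪ ⁅ g ⁆) iB+g (p⊆p∪q ⁅ g ⁆) (q⊆p∪q B ⁅ g ⁆ (x∈⁅x⁆ g))) g∉B

  indep-∣basis∣⇒basis : ∀ {B X} → IsBasis M B → Indep X → ∣ B ∣ ≤ ∣ X ∣ → IsBasis M X
  indep-∣basis∣⇒basis bB iX ∣B∣≤∣X∣ =
    iX , λ Y iY X⊆Y → p⊆q∧∣q∣≤∣p∣⇒q⊆p X⊆Y (≤-trans (∣indep∣≤∣basis∣ bB iY) ∣B∣≤∣X∣)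

  circuit-delete-indep : ∀ {C e} → IsCircuit M C → e ∈ C → Indep (C - e)
  circuit-delete-indep {C} (_ , minC) e∈C =
    minC (C - _) (p─q⊆p C _) (λ C⊆C-e → x∈p-y⇒x≢y C (C⊆C-e e∈C) refl)

  -- C - e extends to an independent Z of the size of B inside (C - e) ∪ B ⊆ B ∪ ⁅ e′ ⁆;
  -- Z avoids e (otherwise it contains C), so Z ⊆ B′ and the two have the same size.
  basis-exchange : ∀ {B e e′} → IsBasis M B → e ∈ B → e′ ∉ B → InFundCircuit M B e′ e →
                   IsBasis M ((B - e) ∪ ⁅ e′ ⁆)
  basis-exchange {B} {e} {e′} bB@(iB , _) e∈B e′∉B (C , cC , C⊆B+e′ , e∈C)
    with indep-grow (circuit-delete-indep cC e∈C) iB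
  ... | Z , iZ , C-e⊆Z , Z⊆C-e∪B , ∣B∣≤∣Z∣ =
    indep-∣basis∣⇒basis bB iB′ (≤-trans ∣B∣≤∣Z∣ (p⊆q⇒∣p∣≤∣q∣ Z⊆B′))
    where
    B′ : Subset n
    B′ = (B - e) ∪ ⁅ e′ ⁆

    e∉Z : e ∉ Z
    e∉Z e∈Z = proj₁ cC (indep-sub C⊆Z iZ)
      where
      C⊆Z : C ⊆ Z
      C⊆Z {c} c∈C with c ≟ e
      ... | yes refl = e∈Z
      ... | no  c≢e  = C-e⊆Z (x∈p∧x≢y⇒x∈p-y c∈C c≢e)

    Z⊆B′ : Z ⊆ B′
    Z⊆B′ {z} z∈Z with x∈p∪q⁻ (C - e) B (Z⊆C-e∪B z∈Z)
    ... | inj₂ z∈B = p⊆p∪q ⁅ e′ ⁆ (x∈p∧x≢y⇒x∈p-y z∈B λ { refl → e∉Z z∈Z })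
    ... | inj₁ z∈C-e with x∈p∪q⁻ B ⁅ e′ ⁆ (C⊆B+e′ (p─q⊆p C ⁅ e ⁆ z∈C-e))
    ...   | inj₁ z∈B  = p⊆p∪q ⁅ e′ ⁆ (x∈p∧x≢y⇒x∈p-y z∈B (x∈p-y⇒x≢y C z∈C-e))
    ...   | inj₂ z∈e′ = q⊆p∪q (B - e) ⁅ e′ ⁆ z∈e′

    iB′ : Indep B′
    iB′ = indep-sub (p⊆q∧∣q∣≤∣p∣⇒q⊆p Z⊆B′ (≤-trans (x∈p⇒∣p-x∪⁅y⁆∣≤∣p∣ e∈B) ∣B∣≤∣Z∣)) iZ

module WeightSums (G : OrderedAbelianGroup) where
  open OrderedAbelianGroup G
  open import Relation.Binary.Bundles using (Poset)

  ≤-reflexive : ∀ {x y} → x ≡ y → x ≤ y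
  ≤-reflexive refl = ≤-refl _

  poset : Poset _ _ _
  poset = record
    { _≈_ = _≡_
    ; _≤_ = _≤_
    ; isPartialOrder = record
      { isPreorder = record
        { isEquivalence = isEquivalence
        ; reflexive = ≤-reflexive
        ; trans = ≤-trans
        }
      ; antisym = ≤-antisym
      }
    }

  open import Relation.Binary.Reasoning.PartialOrder poset

  +-monoʳ-≤ : ∀ {x y} z → x ≤ y → z + x ≤ z + y
  +-monoʳ-≤ {x} {y} z x≤y = subst₂ _≤_ (+-comm x z) (+-comm y z) (+-mono-≤ z x≤y)

  +-cancelˡ-≤ : ∀ {x y} z → z + x ≤ z + y → x ≤ y
  +-cancelˡ-≤ {x} {y} z z+x≤z+y = subst₂ _≤_ (-z+[z+u]≡u x) (-z+[z+u]≡u y) (+-monoʳ-≤ (- z) z+x≤z+y)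
    where
    -z+[z+u]≡u : ∀ u → (- z) + (z + u) ≡ u
    -z+[z+u]≡u u = trans (sym (+-assoc (- z) z u)) (trans (cong (_+ u) (-‿inverseˡ z)) (+-identityˡ u))

  x+[y+z]≡y+[x+z] : ∀ x y z → x + (y + z) ≡ y + (x + z)
  x+[y+z]≡y+[x+z] x y z = trans (sym (+-assoc x y z)) (trans (cong (_+ z) (+-comm x y)) (+-assoc y x z))

  wsum-cong : ∀ {n} {w v : Fin n → Carrier} (S : Subset n) →
              (∀ i → i ∈ S → w i ≡ v i) → wsum G w S ≡ wsum G v S
  wsum-cong []          w≡v = refl
  wsum-cong (true  ∷ S) w≡v = cong₂ _+_ (w≡v _ here) (wsum-cong S (λ i → w≡v _ ∘ there))
  wsum-cong (false ∷ S) w≡v = cong (0# +_) (wsum-cong S (λ i → w≡v _ ∘ there))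

  wsum-mono : ∀ {n} {w v : Fin n → Carrier} (S : Subset n) →
              (∀ i → i ∈ S → w i ≤ v i) → wsum G w S ≤ wsum G v S
  wsum-mono []          w≤v = ≤-refl 0#
  wsum-mono (true ∷ S) w≤v =
    ≤-trans (+-mono-≤ _ (w≤v _ here)) (+-monoʳ-≤ _ (wsum-mono S (λ i → w≤v _ ∘ there)))
  wsum-mono (false ∷ S) w≤v = +-monoʳ-≤ 0# (wsum-mono S (λ i → w≤v _ ∘ there))

  -- The zero case unfolds  (true ∷ S) - zero  to  outside ∷ (S ─ ∅).
  wsum-remove : ∀ {n} (w : Fin n → Carrier) {S : Subset n} {a} → a ∈ S →
                wsum G w S ≡ w a + wsum G w (S - a)
  wsum-remove w {true ∷ S} here =
    cong (w _ +_) (sym (trans (+-identityˡ _) (cong (wsum G (w ∘ suc)) (p─⊥≡p S))))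
  wsum-remove w {_ ∷ S} (there a∈S) =
    trans (cong (_ +_) (wsum-remove (w ∘ suc) a∈S)) (x+[y+z]≡y+[x+z] _ _ _)

  wsum-exchange : ∀ {n} (w : Fin n → Carrier) {S : Subset n} {a b} → a ∈ S → b ∉ S → w a ≡ w b →
                  wsum G w ((S - a) ∪ ⁅ b ⁆) ≡ wsum G w S
  wsum-exchange w {S} {a} {b} a∈S b∉S wa≡wb = begin-equality
    wsum G w ((S - a) ∪ ⁅ b ⁆)          ≡⟨ wsum-remove w (q⊆p∪q (S - a) ⁅ b ⁆ (x∈⁅x⁆ b)) ⟩
    w b + wsum G w ((S - a) ∪ ⁅ b ⁆ - b) ≡⟨ cong₂ _+_ (sym wa≡wb) (cong (wsum G w) (p∪⁅x⁆-x≡p (b∉S ∘ p─q⊆p S ⁅ a ⁆))) ⟩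
    w a + wsum G w (S - a)              ≡⟨ wsum-remove w a∈S ⟨
    wsum G w S                          ∎

  -- If a ∈ T the change at a cancels; otherwise only the left-hand side decreases.
  wsum-lower : ∀ {n} {w v : Fin n → Carrier} {a} (S T : Subset n) →
               (∀ i → i ≢ a → w i ≡ v i) → w a ≤ v a → a ∈ S →
               wsum G v S ≤ wsum G v T → wsum G w S ≤ wsum G w T
  wsum-lower {w = w} {v} {a} S T w≡v w≤v a∈S vS≤vT with a ∈? T
  ... | yes a∈T = begin
    wsum G w S            ≡⟨ wsum-remove w a∈S ⟩
    w a + wsum G w (S - a) ≡⟨ cong (w a +_) (agree S) ⟩
    w a + wsum G v (S - a) ≤⟨ +-monoʳ-≤ (w a) (+-cancelˡ-≤ (v a) v-a≤) ⟩
    w a + wsum G v (T - a) ≡⟨ cong (w a +_) (agree T) ⟨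
    w a + wsum G w (T - a) ≡⟨ wsum-remove w a∈T ⟨
    wsum G w T            ∎
    where
    agree : ∀ X → wsum G w (X - a) ≡ wsum G v (X - a)
    agree X = wsum-cong (X - a) (λ i i∈X-a → w≡v i (x∈p-y⇒x≢y X i∈X-a))
    v-a≤ : v a + wsum G v (S - a) ≤ v a + wsum G v (T - a)
    v-a≤ = subst₂ _≤_ (wsum-remove v a∈S) (wsum-remove v a∈T) vS≤vT
  ... | no a∉T = begin
    wsum G w S ≤⟨ wsum-mono S w≤v′ ⟩
    wsum G v S ≤⟨ vS≤vT ⟩
    wsum G v T ≡⟨ wsum-cong T (λ i i∈T → w≡v i λ { refl → a∉T i∈T }) ⟨
    wsum G w T ∎
    where
    w≤v′ : ∀ i → i ∈ S → w i ≤ v i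
    w≤v′ i _ with i ≟ a
    ... | yes refl = w≤v
    ... | no  i≢a  = ≤-reflexive (w≡v i i≢a)

module Consistency (G : OrderedAbelianGroup) {n} (𝓜 : UncertaintyMatroid G n) where
  open OrderedAbelianGroup G
  open UncertaintyMatroid 𝓜

  consistent-⊆ : ∀ {Q Q′ w*} → Q ⊆ Q′ → Consistent G 𝓜 Q′ w* → Consistent G 𝓜 Q w*
  consistent-⊆ Q⊆Q′ (w*∈A , w*≡w) = w*∈A , λ i → w*≡w i ∘ Q⊆Q′

  reset : (Fin n → Carrier) → Fin n → Fin n → Carrier
  reset w* a = updateAt w* a (const (weight a))

  reset-consistent : ∀ {Q w* a} → Consistent G 𝓜 (Q - a) w* → Consistent G 𝓜 Q (reset w* a)
  reset-consistent {Q} {w*} {a} (w*∈A , w*≡w) = reset∈A , reset≡w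
    where
    reset∈A : ∀ i → _∈A_ G (reset w* a i) (area i)
    reset∈A i with i ≟ a
    ... | yes refl = subst (λ x → _∈A_ G x (area i)) (sym (updateAt-updates i w*)) (weight∈area i)
    ... | no  i≢a  = subst (λ x → _∈A_ G x (area i)) (sym (updateAt-minimal i a w* i≢a)) (w*∈A i)
    reset≡w : ∀ i → i ∈ Q → reset w* a i ≡ weight i
    reset≡w i i∈Q with i ≟ a
    ... | yes refl = updateAt-updates i w*
    ... | no  i≢a  = trans (updateAt-minimal i a w* i≢a) (w*≡w i (x∈p∧x≢y⇒x∈p-y i∈Q i≢a))

lemma2p10 : (G : OrderedAbelianGroup) {n : ℕ} (𝓜 : UncertaintyMatroid G n)
    (B Q : Subset n) (e e′ : Fin n) →
    IsMWB G 𝓜 (UncertaintyMatroid.weight 𝓜) B →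
    Verifies G 𝓜 Q B →
    e ∈ B → e′ ∉ B →
    UpperIsWeight G 𝓜 e → UpperIsWeight G 𝓜 e′ →
    UncertaintyMatroid.weight 𝓜 e ≡ UncertaintyMatroid.weight 𝓜 e′ →
    InFundCircuit (UncertaintyMatroid.matroid 𝓜) B e′ e →
    Verifies G 𝓜 ((Q - e′) ∪ ⁅ e ⁆) ((B - e) ∪ ⁅ e′ ⁆)
lemma2p10 G 𝓜 B Q e e′ (bB , _) verQ e∈B e′∉B _ e′-upper we≡we′ e∈Ce′ w* w*-cons@(w*∈A , w*≡w) =
  MatroidProperties.basis-exchange matroid bB e∈B e′∉B e∈Ce′ , B′-minimal
  where
  open OrderedAbelianGroup G
  open UncertaintyMatroid 𝓜
  open WeightSums G
  open Consistency G 𝓜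

  v = reset w* e′
  B′ = (B - e) ∪ ⁅ e′ ⁆

  B-mwb : IsMWB G 𝓜 v B
  B-mwb = verQ v (reset-consistent (consistent-⊆ (p⊆p∪q ⁅ e ⁆) w*-cons))

  ve≡ve′ : v e ≡ v e′
  ve≡ve′ = begin
    v e      ≡⟨ updateAt-minimal e e′ w* (λ { refl → e′∉B e∈B }) ⟩
    w* e     ≡⟨ w*≡w e (q⊆p∪q (Q - e′) ⁅ e ⁆ (x∈⁅x⁆ e)) ⟩
    weight e ≡⟨ we≡we′ ⟩
    weight e′ ≡⟨ updateAt-updates e′ w* ⟨
    v e′     ∎
    where open ≡-Reasoning

  B′-minimal : ∀ B″ → IsBasis matroid B″ → wsum G w* B′ ≤ wsum G w* B″
  B′-minimal B″ bB″ =
    wsum-lower B′ B″ (λ i i≢e′ → sym (updateAt-minimal i e′ w* i≢e′))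
      (subst (w* e′ ≤_) (sym (updateAt-updates e′ w*)) (e′-upper (w* e′) (w*∈A e′)))
      (q⊆p∪q (B - e) ⁅ e′ ⁆ (x∈⁅x⁆ e′))
      (subst (_≤ wsum G v B″) (sym (wsum-exchange v e∈B e′∉B ve≡ve′)) (proj₂ B-mwb B″ bB″))
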